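{- For $n\ge1$ let $\ell_n=\Psi(L_n)$, $z_n=\Psi(Z_n)$, $h_n=\Psi(H_n)$, and set $\ell_0=z_0=h_0=1$. Then: (i) $\ell_n=4\ell_{n-1}+\ell_{n-4}+\ell_{n-5}$ for all $n\ge5$, with $\ell_0=1,\ell_1=5,\ell_2=20,\ell_3=79,\ell_4=317$; (ii) $z_n=3z_{n-1}+z_{n-2}+6z_{n-3}+7z_{n-4}+7z_{n-5}+5z_{n-6}+z_{n-7}$ for all $n\ge7$, with $z_0=1,z_1=5,z_2=20,z_3=75,z_4=288,z_5=1105,z_6=4234$; (iii) $h_n=h_{n-1}+7h_{n-2}+12h_{n-3}+6h_{n-4}+7h_{n-5}+4h_{n-6}+2h_{n-7}$ for all $n\ge7$, with $h_0=1,h_1=5,h_2=20,h_3=75,h_4=288,h_5=1094,h_6=4171$.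
   Context: All graphs are finite and simple. A matching of a graph $G$ is a set of edges no two of which share a vertex; it is maximal if it is not a proper subset of another matching of $G$. $\Psi(G)$ denotes the number of maximal matchings of $G$. A hexagon is a cycle on 6 vertices. A benzenoid chain of length $n\ge1$ is a graph that is the union of $n$ hexagons $h_1,\dots,h_n$ such that, for $1\le i\le n-1$, $h_i$ and $h_{i+1}$ share exactly one edge $e_i$ (and its two endpoints) and no other vertex, hexagons $h_i,h_j$ with $|i-j|\ge2$ are vertex-disjoint, and no vertex lies in three hexagons (so for $2\le i\le n-1$ the edges $e_{i-1},e_i$ are disjoint edges of $h_i$). An internal hexagon $h_i$ ($2\le i\le n-1$) is straight if no endpoint of $e_{i-1}$ is adjacent in $h_i$ to an endpoint of $e_i$, and kinky otherwise; in a kinky $h_i$ exactly one endpoint of $e_i$ is adjacent in $h_i$ to an endpoint of $e_{i-1}$, and for $i+1\le n-1$ with $h_{i+1}$ kinky exactly one endpoint of $e_i$ is adjacent in $h_{i+1}$ to an endpoint of $e_{i+1}$. $L_n$ (polyacene) is the benzenoid chain of length $n$ all of whose internal hexagons are straight. $Z_n$ (zig-zag polyphenacene) and $H_n$ (helicene) are the benzenoid chains of length $n$ all of whose internal hexagons are kinky and such that, for every $2\le i\le n-2$, the endpoint of $e_i$ adjacent in $h_i$ to an endpoint of $e_{i-1}$ and the endpoint of $e_i$ adjacent in $h_{i+1}$ to an endpoint of $e_{i+1}$ are different vertices (for $Z_n$), respectively the same vertex (for $H_n$). Each of $L_n,Z_n,H_n$ is unique up to isomorphism. -}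

module Defs where

open import Data.Nat using (ℕ; zero; suc; _+_; _≟_)
open import Data.Product using (_×_; _,_; ∃; ∃-syntax)
open import Data.List using (List; []; _∷_; _++_; length; lookup; map; filter)
open import Data.Fin using (Fin)
open import Data.Fin.Properties using (all?)
open import Data.Fin.Subset using (Subset; _∈_; _⊂_; inside; outside)
open import Data.Fin.Subset.Properties using (_∈?_; _⊂?_; anySubset?)
open import Data.Vec using ([]; _∷_)
open import Relation.Binary.PropositionalEquality using (_≡_; _≢_)
open import Relation.Nullary using (Dec; ¬_)
open import Relation.Nullary.Decidable using (¬?; _×-dec_; _→-dec_)
import Data.Fin as F

-- Finite simple graphs, given by their (duplicate-free, loop-free) list
-- of edges; an edge is an unordered pair {a , b} of vertices (vertices
-- are natural numbers).  Isolated vertices play no role for matchings.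

Graph : Set
Graph = List (ℕ × ℕ)

Edge : Graph → Set
Edge G = Fin (length G)

edge : (G : Graph) → Edge G → ℕ × ℕ
edge G i = lookup G i

VertexDisjoint : ℕ × ℕ → ℕ × ℕ → Set
VertexDisjoint (a , b) (c , d) = (a ≢ c) × (a ≢ d) × (b ≢ c) × (b ≢ d)

EdgeSet : Graph → Set
EdgeSet G = Subset (length G)

IsMatching : (G : Graph) → EdgeSet G → Set
IsMatching G M = ∀ i j → i ∈ M → j ∈ M → i ≢ j → VertexDisjoint (edge G i) (edge G j)

IsMaximalMatching : (G : Graph) → EdgeSet G → Set
IsMaximalMatching G M = IsMatching G M × ¬ (∃[ M′ ] (IsMatching G M′ × M ⊂ M′))

vertexDisjoint? : ∀ e f → Dec (VertexDisjoint e f)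
vertexDisjoint? (a , b) (c , d) =
  ¬? (a ≟ c) ×-dec ¬? (a ≟ d) ×-dec ¬? (b ≟ c) ×-dec ¬? (b ≟ d)

isMatching? : (G : Graph) → (M : EdgeSet G) → Dec (IsMatching G M)
isMatching? G M = all? λ i → all? λ j →
  (i ∈? M) →-dec (j ∈? M) →-dec ¬? (i F.≟ j) →-dec vertexDisjoint? (edge G i) (edge G j)

isMaximalMatching? : (G : Graph) → (M : EdgeSet G) → Dec (IsMaximalMatching G M)
isMaximalMatching? G M =
  isMatching? G M ×-dec ¬? (anySubset? λ M′ → isMatching? G M′ ×-dec (M ⊂? M′))

allSubsets : (m : ℕ) → List (Subset m)
allSubsets zero    = [] ∷ []
allSubsets (suc m) = map (inside ∷_) (allSubsets m) ++ map (outside ∷_) (allSubsets m)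

Ψ : Graph → ℕ
Ψ G = length (filter (isMaximalMatching? G) (allSubsets (length G)))

-- Given the current shared edge as an ordered pair (a , b) and the next
-- fresh vertex k, the next hexagon is the cycle a-k-(k+1)-(k+2)-(k+3)-b-a
-- (it shares exactly the edge {a,b} with the previous hexagon).  The next
-- shared edge is chosen among the edges of this hexagon disjoint from {a,b}:
--   straight : {k+1 , k+2}                         (used for L_n)
--   helix    : (k , k+1)  -- kink vertex k again the "first" endpoint (H_n)
--   zigzag   : (k+1 , k)  -- kink alternates sides                     (Z_n)
-- In the next hexagon x-q1-q2-q3-q4-y built on the ordered pair (x , y),
-- a kinky choice always takes {q1,q2}, so the endpoint of the shared edge
-- adjacent to the following shared edge is x.  With (x , y) = (k , k+1)
-- this is k, which is also the endpoint adjacent (via a) to the previous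
-- shared edge: helicene.  With (x , y) = (k+1 , k) the two are different:
-- zig-zag.

data Kind : Set where
  straight helix zigzag : Kind

nextEdge : Kind → ℕ → ℕ × ℕ
nextEdge straight k = (suc k , suc (suc k))
nextEdge helix    k = (k , suc k)
nextEdge zigzag   k = (suc k , k)

grow : Kind → ℕ → ℕ → ℕ × ℕ → Graph
grow κ zero    k ab      = []
grow κ (suc r) k (a , b) =
  (a , k) ∷ (k , k + 1) ∷ (k + 1 , k + 2) ∷ (k + 2 , k + 3) ∷ (k + 3 , b)
  ∷ grow κ r (k + 4) (nextEdge κ k)

hexagon₁ : Graph
hexagon₁ = (0 , 1) ∷ (1 , 2) ∷ (2 , 3) ∷ (3 , 4) ∷ (4 , 5) ∷ (5 , 0) ∷ []

-- The benzenoid chain of length n of the given kind (n ≥ 1; for n = 0 we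
-- return the empty graph, which is never used by the statement).
chain : Kind → ℕ → Graph
chain κ zero    = []
chain κ (suc r) = hexagon₁ ++ grow κ r 6 (0 , 1)

Lₙ Zₙ Hₙ : ℕ → Graph
Lₙ = chain straight
Zₙ = chain zigzag
Hₙ = chain helix

withZero : (ℕ → Graph) → ℕ → ℕ
withZero G zero    = 1
withZero G (suc n) = Ψ (G (suc n))

ℓ z h : ℕ → ℕ
ℓ = withZero Lₙ
z = withZero Zₙ
h = withZero Hₙ

-- Proof by the transfer-matrix method.
--  * Ψ(G) counts the labellings (edge subsets) of G in which every
--    selected edge has both endpoints of degree one and every unselected
--    edge has an endpoint of positive degree (Ψ≡∑valid).
--  * Gluing: if two parts of a graph share only the ends a, b of an edge,
--    the count for the whole graph is a scalar product, over the nine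
--    boundary states recording how a and b are matched, of counts for the
--    two parts (Gluing.glue).
--  * All tails of a chain are relabelled copies of a standard tail, so
--    their counts form vectors W_r with W_{r+1} = T W_r for an explicit
--    9×9 transfer matrix T, and Ψ of the chain of r+1 hexagons is u · W_r
--    (tailVector-step, Ψ-chain).
--  * If u T^k = Σᵢ cᵢ u T^i, then s_r = u T^r W₀ satisfies
--    s_{m+k} = Σᵢ cᵢ s_{m+i} (recurrence).
--  * The relations u T^k = Σᵢ cᵢ u T^i, the case n = 0 and the initial
--    values are finite computations, checked by evaluation.
module Submission where

open import Defs
open import Data.Nat using (ℕ; zero; suc; _+_; _*_; _≤_; _<_; z≤n; s≤s; _≡ᵇ_; _≟_; _<?_)
open import Data.Nat.Properties
open import Data.Nat.Tactic.RingSolver using (solve-∀)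
import Data.Nat.ListAction as List
open import Data.Nat.ListAction.Properties using (sum-++)
open import Algebra.Properties.Semiring.Sum +-*-semiring
  using (sum; ∑-comm; ∑-distrib-+; *-distribˡ-sum; *-distribʳ-sum; sum-cong-≗; sum-replicate-zero)
open import Data.Bool using (Bool; true; false; _∧_; _∨_; not; if_then_else_; T)
open import Data.Bool.Properties using (∨-zeroʳ; ∧-assoc)
open import Data.Product using (_×_; _,_; proj₁; proj₂; map₁; ∃-syntax)
open import Data.Sum using (_⊎_; inj₁; inj₂; [_,_]′)
open import Data.List using (List; []; _∷_; _++_; length; map; filter)
open import Data.List.Properties using (map-++; map-∘; map-cong)
open import Data.List.Relation.Unary.All using (All; []; _∷_)
import Data.List.Relation.Unary.All as All
open import Data.Fin using (Fin; zero; suc)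
open import Data.Fin.Properties using () renaming (_≟_ to _≟ᶠ_; suc-injective to fsuc-injective)
open import Data.Fin.Patterns
open import Data.Fin.Subset using (_∈_; _⊂_; inside; outside)
open import Data.Vec using (Vec; []; _∷_; lookup; tabulate; replicate; _[_]≔_)
open import Data.Vec.Properties
  using ([]=⇒lookup; lookup⇒[]=; lookup∘update′; []≔-minimal; []≔-updates; lookup∘tabulate; tabulate-cong;
         lookup-replicate; ≡-dec)
open import Data.Empty using (⊥; ⊥-elim)
open import Function using (_∘_)
open import Relation.Nullary using (¬_; Dec; yes; no; does; _×-dec_)
open import Relation.Nullary.Decidable using (toWitness; True)
open import Relation.Binary.PropositionalEquality hiding ([_])

χ : Bool → ℕ
χ true  = 1
χ false = 0

true≢false : true ≢ false
true≢false ()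

≡ᵇ-true : ∀ {m n} → (m ≡ᵇ n) ≡ true → m ≡ n
≡ᵇ-true {m} {n} eq = ≡ᵇ⇒≡ m n (subst T (sym eq) _)

≡ᵇ-refl : ∀ n → (n ≡ᵇ n) ≡ true
≡ᵇ-refl zero    = refl
≡ᵇ-refl (suc n) = ≡ᵇ-refl n

≡ᵇ-false : ∀ {m n} → m ≢ n → (m ≡ᵇ n) ≡ false
≡ᵇ-false {m} {n} m≢n with m ≡ᵇ n in eq
... | true  = ⊥-elim (m≢n (≡ᵇ-true eq))
... | false = refl

covers : ℕ × ℕ → ℕ → Bool
covers (u , w) v = (v ≡ᵇ u) ∨ (v ≡ᵇ w)

covers-fst : ∀ e → covers e (proj₁ e) ≡ true
covers-fst (u , w) rewrite ≡ᵇ-refl u = refl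

covers-snd : ∀ e → covers e (proj₂ e) ≡ true
covers-snd (u , w) rewrite ≡ᵇ-refl w = ∨-zeroʳ (w ≡ᵇ u)

covers-none : ∀ {u w v} → v ≢ u → v ≢ w → covers (u , w) v ≡ false
covers-none v≢u v≢w rewrite ≡ᵇ-false v≢u | ≡ᵇ-false v≢w = refl

covers-endpoint : ∀ e v → covers e v ≡ true → v ≡ proj₁ e ⊎ v ≡ proj₂ e
covers-endpoint (u , w) v c with v ≡ᵇ u in e₁ | v ≡ᵇ w in e₂
... | true  | _     = inj₁ (≡ᵇ-true e₁)
... | false | true  = inj₂ (≡ᵇ-true e₂)
... | false | false = ⊥-elim (true≢false (sym c))

disjoint⇒uncovered : ∀ {e f} v → VertexDisjoint e f → covers e v ≡ true → covers f v ≡ false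
disjoint⇒uncovered {e = e} v (u≢c , u≢d , w≢c , w≢d) c with covers-endpoint e v c
... | inj₁ refl = covers-none u≢c u≢d
... | inj₂ refl = covers-none w≢c w≢d

no-common⇒disjoint : ∀ {u w c d} → (∀ v → covers (u , w) v ≡ true → covers (c , d) v ≡ true → ⊥) →
                     VertexDisjoint (u , w) (c , d)
no-common⇒disjoint {u} {w} {c} {d} common =
    (λ { refl → common u (covers-fst (u , w)) (covers-fst (u , d)) })
  , (λ { refl → common u (covers-fst (u , w)) (covers-snd (c , u)) })
  , (λ { refl → common w (covers-snd (u , w)) (covers-fst (w , d)) })
  , (λ { refl → common w (covers-snd (u , w)) (covers-snd (c , w)) })

term≤sum : ∀ {n} (f : Fin n → ℕ) i → f i ≤ sum f
term≤sum f zero    = m≤m+n _ _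
term≤sum f (suc i) = ≤-trans (term≤sum (λ j → f (suc j)) i) (m≤n+m _ _)

two-terms≤sum : ∀ {n} (f : Fin n → ℕ) i j → i ≢ j → f i + f j ≤ sum f
two-terms≤sum f zero    zero    i≢j = ⊥-elim (i≢j refl)
two-terms≤sum f zero    (suc j) _   = +-monoʳ-≤ (f zero) (term≤sum (λ k → f (suc k)) j)
two-terms≤sum f (suc i) zero    _   =
  subst (_≤ sum f) (+-comm (f zero) (f (suc i))) (+-monoʳ-≤ (f zero) (term≤sum (λ k → f (suc k)) i))
two-terms≤sum f (suc i) (suc j) i≢j =
  ≤-trans (two-terms≤sum (λ k → f (suc k)) i j (λ e → i≢j (cong suc e))) (m≤n+m _ _)

sum-single : ∀ {n} (f : Fin n → ℕ) i → (∀ j → j ≢ i → f j ≡ 0) → sum f ≡ f i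
sum-single {suc n} f zero others =
  trans (cong (f zero +_) (trans (sum-cong-≗ (λ j → others (suc j) (λ ()))) (sum-replicate-zero n)))
        (+-identityʳ _)
sum-single f (suc i) others rewrite others zero (λ ()) =
  sum-single (λ j → f (suc j)) i (λ j j≢i → others (suc j) (λ e → j≢i (fsuc-injective e)))

sum-positive : ∀ {n} (f : Fin n → ℕ) → sum f ≢ 0 → ∃[ j ] f j ≢ 0
sum-positive {zero}  f ∑≢0 = ⊥-elim (∑≢0 refl)
sum-positive {suc n} f ∑≢0 with f zero in e
... | suc _ = zero , λ f0≡0 → 0≢1+n (trans (sym f0≡0) e)
... | zero with sum-positive (λ j → f (suc j)) ∑≢0
...   | j , fj≢0 = suc j , fj≢0

-- Maximal matchings are characterised by a local condition on degrees.

-- A selected edge must have both endpoints of degree one (matching), an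
-- unselected edge must have an endpoint of positive degree (maximality).
Saturated Dominated : (ℕ → ℕ) → ℕ × ℕ → Set
Saturated d (u , w) = d u ≡ 1 × d w ≡ 1
Dominated d (u , w) = d u ≢ 0 ⊎ d w ≢ 0

locallyOK : (ℕ → ℕ) → (ℕ × ℕ) × Bool → Bool
locallyOK d ((u , w) , true)  = (d u ≡ᵇ 1) ∧ (d w ≡ᵇ 1)
locallyOK d ((u , w) , false) = not (d u ≡ᵇ 0) ∨ not (d w ≡ᵇ 0)

saturated⇒ok : ∀ d e → Saturated d e → locallyOK d (e , true) ≡ true
saturated⇒ok d e (du≡1 , dw≡1) rewrite du≡1 | dw≡1 = refl

ok⇒saturated : ∀ d e → locallyOK d (e , true) ≡ true → Saturated d e
ok⇒saturated d (u , w) ok with d u ≡ᵇ 1 in eu | d w ≡ᵇ 1 in ew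
... | true  | true  = ≡ᵇ-true eu , ≡ᵇ-true ew
... | true  | false = ⊥-elim (true≢false (sym ok))
... | false | _     = ⊥-elim (true≢false (sym ok))

dominated⇒ok : ∀ d e → Dominated d e → locallyOK d (e , false) ≡ true
dominated⇒ok d (u , w) dom with d u | d w
... | suc _ | _     = refl
... | zero  | suc _ = refl
... | zero  | zero  with dom
...   | inj₁ du≢0 = ⊥-elim (du≢0 refl)
...   | inj₂ dw≢0 = ⊥-elim (dw≢0 refl)

ok⇒dominated : ∀ d e → locallyOK d (e , false) ≡ true → Dominated d e
ok⇒dominated d (u , w) ok with d u | d w
... | suc _ | _     = inj₁ (λ ())
... | zero  | suc _ = inj₂ (λ ())
... | zero  | zero  = ⊥-elim (true≢false (sym ok))

saturated-endpoint : ∀ {d} e v → Saturated d e → covers e v ≡ true → d v ≡ 1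
saturated-endpoint e v (du≡1 , dw≡1) c with covers-endpoint e v c
... | inj₁ refl = du≡1
... | inj₂ refl = dw≡1

disjoint-sym : ∀ {e f} → VertexDisjoint e f → VertexDisjoint f e
disjoint-sym (u≢c , u≢d , w≢c , w≢d) =
  (λ e → u≢c (sym e)) , (λ e → w≢c (sym e)) , (λ e → u≢d (sym e)) , (λ e → w≢d (sym e))

module Characterisation (G : Graph) (M : EdgeSet G) where

  selected : Edge G → Bool
  selected = lookup M

  ∈⇒selected : ∀ {i} → i ∈ M → selected i ≡ true
  ∈⇒selected = []=⇒lookup

  selected⇒∈ : ∀ {i} → selected i ≡ true → i ∈ M
  selected⇒∈ {i} = lookup⇒[]= i M

  degM : ℕ → ℕ
  degM v = sum (λ i → χ (selected i ∧ covers (edge G i) v))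

  hit≡1 : ∀ {i} v → selected i ≡ true → covers (edge G i) v ≡ true → χ (selected i ∧ covers (edge G i) v) ≡ 1
  hit≡1 v s c rewrite s | c = refl

  hit≢0 : ∀ {i} v → χ (selected i ∧ covers (edge G i) v) ≢ 0 → selected i ≡ true × covers (edge G i) v ≡ true
  hit≢0 {i} v h with selected i | covers (edge G i) v
  ... | true  | true  = refl , refl
  ... | true  | false = ⊥-elim (h refl)
  ... | false | _     = ⊥-elim (h refl)

  covered⇒degree≥1 : ∀ {i} v → selected i ≡ true → covers (edge G i) v ≡ true → 1 ≤ degM v
  covered⇒degree≥1 {i} v s c = subst (_≤ degM v) (hit≡1 v s c) (term≤sum _ i)

  degree≢0⇒covered : ∀ v → degM v ≢ 0 → ∃[ j ] (selected j ≡ true × covers (edge G j) v ≡ true)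
  degree≢0⇒covered v d≢0 with sum-positive _ d≢0
  ... | j , hit = j , hit≢0 v hit

  matching⇒saturated : IsMatching G M → ∀ i → selected i ≡ true → Saturated degM (edge G i)
  matching⇒saturated matching i s =
    at-endpoint (proj₁ (edge G i)) (covers-fst (edge G i)) , at-endpoint (proj₂ (edge G i)) (covers-snd (edge G i))
    where
    at-endpoint : ∀ v → covers (edge G i) v ≡ true → degM v ≡ 1
    at-endpoint v c = trans (sum-single _ i others) (hit≡1 v s c)
      where
      others : ∀ j → j ≢ i → χ (selected j ∧ covers (edge G j) v) ≡ 0
      others j j≢i with selected j in sj
      ... | false = refl
      ... | true = cong χ (disjoint⇒uncovered v
                             (matching i j (selected⇒∈ s) (selected⇒∈ sj) (λ e → j≢i (sym e))) c)

  saturated⇒matching : (∀ i → selected i ≡ true → Saturated degM (edge G i)) → IsMatching G M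
  saturated⇒matching saturated i j i∈M j∈M i≢j = no-common⇒disjoint common
    where
    si : selected i ≡ true
    si = ∈⇒selected i∈M
    sj : selected j ≡ true
    sj = ∈⇒selected j∈M
    common : ∀ v → covers (edge G i) v ≡ true → covers (edge G j) v ≡ true → ⊥
    common v ci cj with subst₂ _≤_ (cong₂ _+_ (hit≡1 v si ci) (hit≡1 v sj cj))
                                   (saturated-endpoint (edge G i) v (saturated i si) ci)
                                   (two-terms≤sum (λ k → χ (selected k ∧ covers (edge G k) v)) i j i≢j)
    ... | s≤s ()

  -- An edge whose endpoints are both unmatched can be added to M.
  maximal⇒dominated : IsMaximalMatching G M → ∀ i → selected i ≡ false → Dominated degM (edge G i)
  maximal⇒dominated (matching , unextendable) i si with degM (proj₁ (edge G i)) ≟ 0 | degM (proj₂ (edge G i)) ≟ 0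
  ... | no du≢0 | _       = inj₁ du≢0
  ... | yes _   | no dw≢0 = inj₂ dw≢0
  ... | yes du≡0 | yes dw≡0 = ⊥-elim (unextendable (M′ , matching′ , M⊂M′))
    where
    M′ : EdgeSet G
    M′ = M [ i ]≔ true

    old : ∀ {j} → j ≢ i → j ∈ M′ → j ∈ M
    old j≢i j∈M′ = selected⇒∈ (trans (sym (lookup∘update′ j≢i M true)) ([]=⇒lookup j∈M′))

    fresh : ∀ j → j ∈ M → VertexDisjoint (edge G i) (edge G j)
    fresh j j∈M = no-common⇒disjoint λ v ci cj →
      case (covers-endpoint (edge G i) v ci) (covered⇒degree≥1 v (∈⇒selected j∈M) cj)
      where
      case : ∀ {v} → v ≡ proj₁ (edge G i) ⊎ v ≡ proj₂ (edge G i) → 1 ≤ degM v → ⊥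
      case (inj₁ refl) le rewrite du≡0 with le
      ... | ()
      case (inj₂ refl) le rewrite dw≡0 with le
      ... | ()

    matching′ : IsMatching G M′
    matching′ j k j∈ k∈ j≢k with j ≟ᶠ i | k ≟ᶠ i
    ... | yes refl | yes refl = ⊥-elim (j≢k refl)
    ... | yes refl | no k≢i   = fresh k (old k≢i k∈)
    ... | no j≢i   | yes refl = disjoint-sym (fresh j (old j≢i j∈))
    ... | no j≢i   | no k≢i   = matching j k (old j≢i j∈) (old k≢i k∈) j≢k

    M⊂M′ : M ⊂ M′
    M⊂M′ = (λ {j} j∈M → []≔-minimal M j i (j≢i j∈M) j∈M)
         , i , []≔-updates M i , λ i∈M → true≢false (trans (sym (∈⇒selected i∈M)) si)
      where
      j≢i : ∀ {j} → j ∈ M → j ≢ i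
      j≢i j∈M refl = true≢false (trans (sym (∈⇒selected j∈M)) si)

  dominated⇒maximal : (∀ i → selected i ≡ false → Dominated degM (edge G i)) →
                      ¬ (∃[ M′ ] (IsMatching G M′ × M ⊂ M′))
  dominated⇒maximal dominated (M′ , matching′ , (M⊆M′ , i , i∈M′ , i∉M)) =
    [ clash (proj₁ (edge G i)) (covers-fst (edge G i)) , clash (proj₂ (edge G i)) (covers-snd (edge G i)) ]′
      (dominated i si)
    where
    si : selected i ≡ false
    si with selected i in e
    ... | true  = ⊥-elim (i∉M (selected⇒∈ e))
    ... | false = refl
    clash : ∀ v → covers (edge G i) v ≡ true → degM v ≢ 0 → ⊥
    clash v ci d≢0 with degree≢0⇒covered v d≢0
    ... | j , sj , cj = true≢false (trans (sym cj) (disjoint⇒uncovered v disjoint ci))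
      where
      disjoint : VertexDisjoint (edge G i) (edge G j)
      disjoint = matching′ i j i∈M′ (M⊆M′ (selected⇒∈ sj)) λ { refl → true≢false (trans (sym sj) si) }

  LocallyValid : Set
  LocallyValid = ∀ i → locallyOK degM (edge G i , selected i) ≡ true

  maximal⇒valid : IsMaximalMatching G M → LocallyValid
  maximal⇒valid maximal i with selected i in si
  ... | true  = saturated⇒ok degM (edge G i) (matching⇒saturated (proj₁ maximal) i si)
  ... | false = dominated⇒ok degM (edge G i) (maximal⇒dominated maximal i si)

  valid⇒maximal : LocallyValid → IsMaximalMatching G M
  valid⇒maximal valid =
      saturated⇒matching (λ i si → ok⇒saturated degM (edge G i) (ok-at i si))
    , dominated⇒maximal (λ i si → ok⇒dominated degM (edge G i) (ok-at i si))
    where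
    ok-at : ∀ i {s} → selected i ≡ s → locallyOK degM (edge G i , s) ≡ true
    ok-at i refl = valid i

-- Labellings: an edge list with a selection bit per edge, i.e. an edge
-- set of the graph given by its list of edges.

Labelling : Set
Labelling = List ((ℕ × ℕ) × Bool)

data LabellingOf : Graph → Labelling → Set where
  []  : LabellingOf [] []
  _∷_ : ∀ {e G L} s → LabellingOf G L → LabellingOf (e ∷ G) ((e , s) ∷ L)

degree : Labelling → ℕ → ℕ
degree []            v = 0
degree ((e , s) ∷ L) v = χ (s ∧ covers e v) + degree L v

validFor : (ℕ → ℕ) → Labelling → Bool
validFor d []      = true
validFor d (x ∷ L) = locallyOK d x ∧ validFor d L

-- L encodes a maximal matching.
valid : Labelling → Bool
valid L = validFor (degree L) L

labelling : (G : Graph) → EdgeSet G → Labelling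
labelling []      []      = []
labelling (e ∷ G) (s ∷ M) = (e , s) ∷ labelling G M

∑ₗ : Graph → (Labelling → ℕ) → ℕ
∑ₗ []      f = f []
∑ₗ (e ∷ G) f = ∑ₗ G (λ L → f ((e , true) ∷ L)) + ∑ₗ G (λ L → f ((e , false) ∷ L))

∧-true : ∀ {a b} → (a ∧ b) ≡ true → a ≡ true × b ≡ true
∧-true {true} {true} _ = refl , refl

locallyOK-cong : ∀ {d d′} e s → d (proj₁ e) ≡ d′ (proj₁ e) → d (proj₂ e) ≡ d′ (proj₂ e) →
                 locallyOK d (e , s) ≡ locallyOK d′ (e , s)
locallyOK-cong e true  p q rewrite p | q = refl
locallyOK-cong e false p q rewrite p | q = refl

validFor-cong : ∀ {d d′} L → (∀ v → d v ≡ d′ v) → validFor d L ≡ validFor d′ L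
validFor-cong []            d≗d′ = refl
validFor-cong ((e , s) ∷ L) d≗d′ = cong₂ _∧_ (locallyOK-cong e s (d≗d′ _) (d≗d′ _)) (validFor-cong L d≗d′)

module _ (G : Graph) (M : EdgeSet G) where
  open Characterisation G M

  degree-labelling : ∀ v → degree (labelling G M) v ≡ degM v
  degree-labelling v = go G M
    where
    go : ∀ G M → degree (labelling G M) v ≡ Characterisation.degM G M v
    go []      []      = refl
    go (e ∷ G) (s ∷ M) = cong (χ (s ∧ covers e v) +_) (go G M)

  validFor-labelling⇒ : ∀ {d} → validFor d (labelling G M) ≡ true →
                        ∀ i → locallyOK d (edge G i , selected i) ≡ true
  validFor-labelling⇒ = go G M
    where
    go : ∀ {d} G M → validFor d (labelling G M) ≡ true → ∀ i → locallyOK d (edge G i , lookup M i) ≡ true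
    go (e ∷ G) (s ∷ M) ok zero    = proj₁ (∧-true ok)
    go (e ∷ G) (s ∷ M) ok (suc i) = go G M (proj₂ (∧-true ok)) i

  validFor-labelling⇐ : ∀ {d} → (∀ i → locallyOK d (edge G i , selected i) ≡ true) →
                        validFor d (labelling G M) ≡ true
  validFor-labelling⇐ = go G M
    where
    go : ∀ {d} G M → (∀ i → locallyOK d (edge G i , lookup M i) ≡ true) → validFor d (labelling G M) ≡ true
    go []      []      _  = refl
    go (e ∷ G) (s ∷ M) ok rewrite ok zero = go G M (λ i → ok (suc i))

  valid⇔locallyValid : (valid (labelling G M) ≡ true → LocallyValid)
                     × (LocallyValid → valid (labelling G M) ≡ true)
  valid⇔locallyValid =
      (λ ok → validFor-labelling⇒ (trans (sym (validFor-cong (labelling G M) degree-labelling)) ok))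
    , (λ ok → trans (validFor-cong (labelling G M) degree-labelling) (validFor-labelling⇐ ok))

does-≡ : ∀ {P : Set} (P? : Dec P) b → (P → b ≡ true) → (b ≡ true → P) → does P? ≡ b
does-≡ (yes p) true  _ _ = refl
does-≡ (yes p) false f _ = sym (f p)
does-≡ (no ¬p) true  _ g = ⊥-elim (¬p (g refl))
does-≡ (no ¬p) false _ _ = refl

maximal?≡valid : ∀ G M → does (isMaximalMatching? G M) ≡ valid (labelling G M)
maximal?≡valid G M = does-≡ (isMaximalMatching? G M) _
  (λ maximal → proj₂ (valid⇔locallyValid G M) (maximal⇒valid maximal))
  (λ ok → valid⇒maximal (proj₁ (valid⇔locallyValid G M) ok))
  where open Characterisation G M

length-filter : ∀ {A : Set} {P : A → Set} (P? : ∀ x → Dec (P x)) xs →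
                length (filter P? xs) ≡ List.sum (map (λ x → χ (does (P? x))) xs)
length-filter P? []       = refl
length-filter P? (x ∷ xs) with does (P? x)
... | true  = cong suc (length-filter P? xs)
... | false = length-filter P? xs

sum-edgeSets : ∀ G (f : Labelling → ℕ) →
               List.sum (map (λ M → f (labelling G M)) (allSubsets (length G))) ≡ ∑ₗ G f
sum-edgeSets []      f = +-identityʳ (f [])
sum-edgeSets (e ∷ G) f = begin
  List.sum (map F (map (inside ∷_) S ++ map (outside ∷_) S))
    ≡⟨ cong List.sum (map-++ F (map (inside ∷_) S) _) ⟩
  List.sum (map F (map (inside ∷_) S) ++ map F (map (outside ∷_) S))
    ≡⟨ sum-++ (map F (map (inside ∷_) S)) _ ⟩
  List.sum (map F (map (inside ∷_) S)) + List.sum (map F (map (outside ∷_) S))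
    ≡⟨ cong₂ _+_ (cong List.sum (sym (map-∘ S))) (cong List.sum (sym (map-∘ S))) ⟩
  List.sum (map (F ∘ (inside ∷_)) S) + List.sum (map (F ∘ (outside ∷_)) S)
    ≡⟨ cong₂ _+_ (sum-edgeSets G (λ L → f ((e , true) ∷ L))) (sum-edgeSets G (λ L → f ((e , false) ∷ L))) ⟩
  ∑ₗ (e ∷ G) f ∎
  where
  open ≡-Reasoning
  S : List (EdgeSet G)
  S = allSubsets (length G)
  F : EdgeSet (e ∷ G) → ℕ
  F M = f (labelling (e ∷ G) M)

Ψ≡∑valid : ∀ G → Ψ G ≡ ∑ₗ G (λ L → χ (valid L))
Ψ≡∑valid G = begin
  length (filter (isMaximalMatching? G) S)
    ≡⟨ length-filter (isMaximalMatching? G) S ⟩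
  List.sum (map (λ M → χ (does (isMaximalMatching? G M))) S)
    ≡⟨ cong List.sum (map-cong (λ M → cong χ (maximal?≡valid G M)) S) ⟩
  List.sum (map (λ M → χ (valid (labelling G M))) S)
    ≡⟨ sum-edgeSets G (λ L → χ (valid L)) ⟩
  ∑ₗ G (λ L → χ (valid L)) ∎
  where
  open ≡-Reasoning
  S : List (EdgeSet G)
  S = allSubsets (length G)

∑ₗ-cong : ∀ G {f g : Labelling → ℕ} → (∀ {L} → LabellingOf G L → f L ≡ g L) → ∑ₗ G f ≡ ∑ₗ G g
∑ₗ-cong []      f≗g = f≗g []
∑ₗ-cong (e ∷ G) f≗g =
  cong₂ _+_ (∑ₗ-cong G (λ p → f≗g (true ∷ p))) (∑ₗ-cong G (λ p → f≗g (false ∷ p)))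

∑ₗ-*ˡ : ∀ G c (f : Labelling → ℕ) → ∑ₗ G (λ L → c * f L) ≡ c * ∑ₗ G f
∑ₗ-*ˡ []      c f = refl
∑ₗ-*ˡ (e ∷ G) c f =
  trans (cong₂ _+_ (∑ₗ-*ˡ G c (λ L → f ((e , true) ∷ L))) (∑ₗ-*ˡ G c (λ L → f ((e , false) ∷ L))))
        (sym (*-distribˡ-+ c _ _))

∑ₗ-*ʳ : ∀ G c (f : Labelling → ℕ) → ∑ₗ G (λ L → f L * c) ≡ ∑ₗ G f * c
∑ₗ-*ʳ []      c f = refl
∑ₗ-*ʳ (e ∷ G) c f =
  trans (cong₂ _+_ (∑ₗ-*ʳ G c (λ L → f ((e , true) ∷ L))) (∑ₗ-*ʳ G c (λ L → f ((e , false) ∷ L))))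
        (sym (*-distribʳ-+ c (∑ₗ G (λ L → f ((e , true) ∷ L))) _))

∑ₗ-++ : ∀ P R (f : Labelling → ℕ) → ∑ₗ (P ++ R) f ≡ ∑ₗ P (λ LP → ∑ₗ R (λ LR → f (LP ++ LR)))
∑ₗ-++ []      R f = refl
∑ₗ-++ (e ∷ P) R f =
  cong₂ _+_ (∑ₗ-++ P R (λ L → f ((e , true) ∷ L))) (∑ₗ-++ P R (λ L → f ((e , false) ∷ L)))

∑ₗ-sum : ∀ G {n} (f : Fin n → Labelling → ℕ) → ∑ₗ G (λ L → sum (λ t → f t L)) ≡ sum (λ t → ∑ₗ G (f t))
∑ₗ-sum []      f = refl
∑ₗ-sum (e ∷ G) f =
  trans (cong₂ _+_ (∑ₗ-sum G (λ t L → f t ((e , true) ∷ L))) (∑ₗ-sum G (λ t L → f t ((e , false) ∷ L))))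
        (sym (∑-distrib-+ (λ t → ∑ₗ G (λ L → f t ((e , true) ∷ L)))
                          (λ t → ∑ₗ G (λ L → f t ((e , false) ∷ L)))))

∑ₗ-product : ∀ P R (h g : Labelling → ℕ) →
             ∑ₗ P (λ LP → ∑ₗ R (λ LR → h LP * g LR)) ≡ ∑ₗ P h * ∑ₗ R g
∑ₗ-product P R h g = trans (∑ₗ-cong P (λ {LP} _ → ∑ₗ-*ˡ R (h LP) g)) (∑ₗ-*ʳ P (∑ₗ R g) h)

EdgesAll : (ℕ → Set) → Graph → Set
EdgesAll Q = All (λ e → Q (proj₁ e) × Q (proj₂ e))

EdgesAll-map : ∀ {Q Q′ : ℕ → Set} {G} → (∀ {v} → Q v → Q′ v) → EdgesAll Q G → EdgesAll Q′ G
EdgesAll-map f = All.map (λ { (q₁ , q₂) → f q₁ , f q₂ })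

degree-++ : ∀ L₁ L₂ v → degree (L₁ ++ L₂) v ≡ degree L₁ v + degree L₂ v
degree-++ []             L₂ v = refl
degree-++ ((e , s) ∷ L₁) L₂ v =
  trans (cong (χ (s ∧ covers e v) +_) (degree-++ L₁ L₂ v)) (sym (+-assoc (χ (s ∧ covers e v)) _ _))

degree-avoid : ∀ {G L} v → LabellingOf G L → EdgesAll (_≢ v) G → degree L v ≡ 0
degree-avoid v []      []                = refl
degree-avoid v (s ∷ p) ((u≢v , w≢v) ∷ q) =
  cong₂ _+_ (trans (cong (λ c → χ (s ∧ c)) (covers-none (λ e → u≢v (sym e)) (λ e → w≢v (sym e))))
                   (χ-∧-false s))
            (degree-avoid v p q)
  where
  χ-∧-false : ∀ s → χ (s ∧ false) ≡ 0
  χ-∧-false true  = refl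
  χ-∧-false false = refl

validFor-++ : ∀ d L₁ L₂ → validFor d (L₁ ++ L₂) ≡ (validFor d L₁ ∧ validFor d L₂)
validFor-++ d []       L₂ = refl
validFor-++ d (x ∷ L₁) L₂ =
  trans (cong (locallyOK d x ∧_) (validFor-++ d L₁ L₂)) (sym (∧-assoc (locallyOK d x) _ _))

validFor-congᴳ : ∀ {G L d d′} → LabellingOf G L → EdgesAll (λ v → d v ≡ d′ v) G →
                 validFor d L ≡ validFor d′ L
validFor-congᴳ []                 []            = refl
validFor-congᴳ {e ∷ G} (s ∷ p) ((p₁ , p₂) ∷ q) = cong₂ _∧_ (locallyOK-cong e s p₁ p₂) (validFor-congᴳ p q)

valid⇒degree-one : ∀ d L v → validFor d L ≡ true → degree L v ≢ 0 → d v ≡ 1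
valid⇒degree-one d []                 v ok deg≢0 = ⊥-elim (deg≢0 refl)
valid⇒degree-one d ((e , true)  ∷ L) v ok deg≢0 with covers e v in c
... | true  = saturated-endpoint e v (ok⇒saturated d e (proj₁ (∧-true ok))) c
... | false = valid⇒degree-one d L v (proj₂ (∧-true ok)) deg≢0
valid⇒degree-one d ((e , false) ∷ L) v ok deg≢0 = valid⇒degree-one d L v (proj₂ (∧-true ok)) deg≢0

-- Let a graph split into a head part and a tail part
-- which share only the two ends a, b of an edge.  In a matching, each of
-- a and b is unmatched, matched by a head edge, or matched by a tail
-- edge; a state records this for a and b.

data Side : Set where
  free byHead byTail : Side

headDegree tailDegree : Side → ℕ
headDegree byHead = 1
headDegree _      = 0
tailDegree byTail = 1
tailDegree _      = 0

State : Set
State = Fin 9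

sides : State → Side × Side
sides 0F = free   , free
sides 1F = free   , byHead
sides 2F = free   , byTail
sides 3F = byHead , free
sides 4F = byHead , byHead
sides 5F = byHead , byTail
sides 6F = byTail , free
sides 7F = byTail , byHead
sides 8F = byTail , byTail

headDegrees tailDegrees : State → ℕ × ℕ
headDegrees t = headDegree (proj₁ (sides t)) , headDegree (proj₂ (sides t))
tailDegrees t = tailDegree (proj₁ (sides t)) , tailDegree (proj₂ (sides t))

_==₂_ : ℕ × ℕ → ℕ × ℕ → Bool
(m , n) ==₂ (m′ , n′) = (m ≡ᵇ m′) ∧ (n ≡ᵇ n′)

==₂-true : ∀ {p q} → p ==₂ q ≡ true → p ≡ q
==₂-true ok = cong₂ _,_ (≡ᵇ-true (proj₁ (∧-true ok))) (≡ᵇ-true (proj₂ (∧-true ok)))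

describes : State → ℕ × ℕ → ℕ × ℕ → Bool
describes t h d = (h ==₂ headDegrees t) ∧ (d ==₂ tailDegrees t)

data SideOf : ℕ → ℕ → Set where
  free   : SideOf 0 0
  byHead : SideOf 1 0
  byTail : SideOf 0 1

sideOf : ∀ p x → p + x ≤ 1 → SideOf p x
sideOf 0             0             _               = free
sideOf 0             1             _               = byTail
sideOf 1             0             _               = byHead
sideOf 0             (suc (suc _)) (s≤s ())
sideOf 1             (suc _)       (s≤s ())
sideOf (suc (suc _)) _             (s≤s ())

unique-state : ∀ pa x pb y → pa + x ≤ 1 → pb + y ≤ 1 → sum (λ t → χ (describes t (pa , pb) (x , y))) ≡ 1
unique-state pa x pb y ha hb with sideOf pa x ha | sideOf pb y hb
... | free   | free   = refl
... | free   | byHead = refl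
... | free   | byTail = refl
... | byHead | free   = refl
... | byHead | byHead = refl
... | byHead | byTail = refl
... | byTail | free   = refl
... | byTail | byHead = refl
... | byTail | byTail = refl

at₂ : ℕ → ℕ → ℕ × ℕ → ℕ → ℕ
at₂ a b (p , q) v = if v ≡ᵇ a then p else (if v ≡ᵇ b then q else 0)

at₂-fst : ∀ a b pq → at₂ a b pq a ≡ proj₁ pq
at₂-fst a b pq rewrite ≡ᵇ-refl a = refl

at₂-snd : ∀ {a b} pq → a ≢ b → at₂ a b pq b ≡ proj₂ pq
at₂-snd {a} {b} pq a≢b rewrite ≡ᵇ-false (λ (e : b ≡ a) → a≢b (sym e)) | ≡ᵇ-refl b = refl

at₂-other : ∀ {a b} v pq → v ≢ a → v ≢ b → at₂ a b pq v ≡ 0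
at₂-other v pq v≢a v≢b rewrite ≡ᵇ-false v≢a | ≡ᵇ-false v≢b = refl

infixl 6 _+ᶠ_
_+ᶠ_ : (ℕ → ℕ) → (ℕ → ℕ) → ℕ → ℕ
(f +ᶠ g) v = f v + g v

degreesAt : Labelling → ℕ → ℕ → ℕ × ℕ
degreesAt L a b = degree L a , degree L b

-- Vertices on the tail side of the boundary edge {a , b}.
Beyond : ℕ → ℕ → ℕ → ℕ → Set
Beyond a b k v = v ≡ a ⊎ v ≡ b ⊎ k ≤ v

-- Validity of a tail labelling when the head contributes degrees h at a, b.
tailValid : ℕ → ℕ → ℕ × ℕ → Labelling → Bool
tailValid a b h LR = validFor (at₂ a b h +ᶠ degree LR) LR

-- tailCount R a b t counts the labellings of a tail R with boundary
-- {a , b} whose degrees at a, b are the tail-side degrees of t and which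
-- are valid when the head contributes the head-side degrees of t.
tailTerm : ℕ → ℕ → State → Labelling → ℕ
tailTerm a b t LR = χ (degreesAt LR a b ==₂ tailDegrees t) * χ (tailValid a b (headDegrees t) LR)

tailCount : Graph → ℕ → ℕ → State → ℕ
tailCount R a b t = ∑ₗ R (tailTerm a b t)

-- The head-side counterpart: headCount t counts (with weight J) the
-- labellings of a head P whose degrees at a, b are the head-side degrees
-- of t and which are valid when the tail contributes the tail-side
-- degrees of t and D further degrees.
module HeadCount (P : Graph) (a b : ℕ) (D : ℕ → ℕ) (J : Labelling → ℕ) where

  headValid : ℕ × ℕ → Labelling → Bool
  headValid d LP = validFor (D +ᶠ degree LP +ᶠ at₂ a b d) LP

  headTerm : State → Labelling → ℕ
  headTerm t LP = χ (degreesAt LP a b ==₂ headDegrees t) * (χ (headValid (tailDegrees t) LP) * J LP)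

  headCount : State → ℕ
  headCount t = ∑ₗ P (headTerm t)

χ-∧ : ∀ p q → χ (p ∧ q) ≡ χ p * χ q
χ-∧ true  q = sym (+-identityʳ (χ q))
χ-∧ false q = refl

-- A head P (vertices below k) glued to a tail R (vertices a, b or ≥ k):
-- counting valid labellings of P ++ R is a scalar product of head and
-- tail counts indexed by the boundary state.
module Gluing (P R : Graph) (a b k : ℕ) (a<k : a < k) (b<k : b < k) (a≢b : a ≢ b)
              (P-below : EdgesAll (_< k) P) (R-beyond : EdgesAll (Beyond a b k) R)
              (D : ℕ → ℕ) (D-beyond : ∀ {v} → Beyond a b k v → D v ≡ 0)
              (J : Labelling → ℕ) (J-head : ∀ {LP LR} → LabellingOf P LP → LabellingOf R LR → J (LP ++ LR) ≡ J LP)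
              where

  open HeadCount P a b D J public

  module _ {LP LR} (pP : LabellingOf P LP) (pR : LabellingOf R LR) where

    L : Labelling
    L = LP ++ LR

    -- Seen from the head, the tail only contributes its degrees at a, b;
    -- seen from the tail, the head (and D) only contribute at a, b.
    tail-seen-from-head : ∀ {v} → v < k → degree LR v ≡ at₂ a b (degreesAt LR a b) v
    tail-seen-from-head {v} v<k with v ≟ a | v ≟ b
    ... | yes refl | _        = sym (at₂-fst a b _)
    ... | no v≢a   | yes refl = sym (at₂-snd _ a≢b)
    ... | no v≢a   | no v≢b   =
      trans (degree-avoid v pR (EdgesAll-map not-v R-beyond)) (sym (at₂-other v _ v≢a v≢b))
      where
      not-v : ∀ {u} → Beyond a b k u → u ≢ v
      not-v (inj₁ refl)        refl = v≢a refl
      not-v (inj₂ (inj₁ refl)) refl = v≢b refl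
      not-v (inj₂ (inj₂ k≤u))  refl = <⇒≱ v<k k≤u

    head-seen-from-tail : ∀ {v} → Beyond a b k v → D v + degree LP v ≡ at₂ a b (degreesAt LP a b) v
    head-seen-from-tail {v} beyond rewrite D-beyond beyond with beyond
    ... | inj₁ refl        = sym (at₂-fst a b _)
    ... | inj₂ (inj₁ refl) = sym (at₂-snd _ a≢b)
    ... | inj₂ (inj₂ k≤v)  =
      trans (degree-avoid v pP (EdgesAll-map (λ u<k u≡v → <⇒≱ (subst (_< k) u≡v u<k) k≤v) P-below))
            (sym (at₂-other v _ (λ { refl → <⇒≱ a<k k≤v }) (λ { refl → <⇒≱ b<k k≤v })))

    V A B : Bool
    V = validFor (D +ᶠ degree L) L
    A = headValid (degreesAt LR a b) LP
    B = tailValid a b (degreesAt LP a b) LR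

    split : V ≡ (A ∧ B)
    split = trans (validFor-++ _ LP LR)
                  (cong₂ _∧_ (validFor-congᴳ pP (EdgesAll-map on-head P-below))
                             (validFor-congᴳ pR (EdgesAll-map on-tail R-beyond)))
      where
      on-head : ∀ {v} → v < k → (D +ᶠ degree L) v ≡ (D +ᶠ degree LP +ᶠ at₂ a b (degreesAt LR a b)) v
      on-head {v} v<k = begin
        D v + degree L v                   ≡⟨ cong (D v +_) (degree-++ LP LR v) ⟩
        D v + (degree LP v + degree LR v)  ≡⟨ sym (+-assoc (D v) _ _) ⟩
        D v + degree LP v + degree LR v    ≡⟨ cong (D v + degree LP v +_) (tail-seen-from-head v<k) ⟩
        D v + degree LP v + at₂ a b (degreesAt LR a b) v ∎
        where open ≡-Reasoning
      on-tail : ∀ {v} → Beyond a b k v → (D +ᶠ degree L) v ≡ (at₂ a b (degreesAt LP a b) +ᶠ degree LR) v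
      on-tail {v} beyond = begin
        D v + degree L v                   ≡⟨ cong (D v +_) (degree-++ LP LR v) ⟩
        D v + (degree LP v + degree LR v)  ≡⟨ sym (+-assoc (D v) _ _) ⟩
        D v + degree LP v + degree LR v    ≡⟨ cong (_+ degree LR v) (head-seen-from-tail beyond) ⟩
        at₂ a b (degreesAt LP a b) v + degree LR v ∎
        where open ≡-Reasoning

    boundary-degree≤1 : ∀ v → Beyond a b k v → V ≡ true → degree LP v + degree LR v ≤ 1
    boundary-degree≤1 v beyond ok with degree L v ≟ 0
    ... | yes deg≡0 = subst (_≤ 1) (degree-++ LP LR v) (subst (_≤ 1) (sym deg≡0) z≤n)
    ... | no deg≢0  = ≤-reflexive (trans (sym (degree-++ LP LR v))
                        (subst (λ x → x + degree L v ≡ 1) (D-beyond beyond) (valid⇒degree-one _ L v ok deg≢0)))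

    -- Only the state describing the actual boundary degrees contributes.
    term : ∀ t → headTerm t LP * tailTerm a b t LR
               ≡ χ (describes t (degreesAt LP a b) (degreesAt LR a b)) * (χ V * J LP)
    term t with degreesAt LP a b ==₂ headDegrees t in head≡ | degreesAt LR a b ==₂ tailDegrees t in tail≡
    ... | false | _     = refl
    ... | true  | false = *-zeroʳ (1 * (χ (headValid (tailDegrees t) LP) * J LP))
    ... | true  | true  = begin
      1 * (χ (headValid (tailDegrees t) LP) * J LP) * (1 * χ (tailValid a b (headDegrees t) LR))
        ≡⟨ cong₂ (λ x y → 1 * (χ x * J LP) * (1 * χ y))
                 (cong (λ d → headValid d LP) (sym (==₂-true tail≡)))
                 (cong (λ h → tailValid a b h LR) (sym (==₂-true head≡))) ⟩
      1 * (χ A * J LP) * (1 * χ B)  ≡⟨ rearrange (χ A) (χ B) (J LP) ⟩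
      1 * (χ A * χ B * J LP)        ≡⟨ cong (λ x → 1 * (x * J LP)) (sym (trans (cong χ split) (χ-∧ A B))) ⟩
      1 * (χ V * J LP) ∎
      where
      open ≡-Reasoning
      rearrange : ∀ x y j → 1 * (x * j) * (1 * y) ≡ 1 * (x * y * j)
      rearrange = solve-∀

    described : State → Bool
    described t = describes t (degreesAt LP a b) (degreesAt LR a b)

    described-once : V ≡ true → sum (λ t → χ (described t)) ≡ 1
    described-once ok = unique-state (degree LP a) (degree LR a) (degree LP b) (degree LR b)
                          (boundary-degree≤1 a (inj₁ refl) ok) (boundary-degree≤1 b (inj₂ (inj₁ refl)) ok)

    weight-once : ∀ v → V ≡ v → sum (λ t → χ (described t) * (χ v * J LP)) ≡ χ v * J LP
    weight-once v V≡v = trans (sym (*-distribʳ-sum (χ v * J LP) (λ t → χ (described t)))) (count v V≡v)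
      where
      count : ∀ v → V ≡ v → sum (λ t → χ (described t)) * (χ v * J LP) ≡ χ v * J LP
      count false _  = *-zeroʳ (sum (λ t → χ (described t)))
      count true  ok = trans (cong (_* (1 * J LP)) (described-once ok)) (*-identityˡ _)

    -- The labelling LP ++ LR is counted once, in the term of its boundary state.
    pointwise : J L * χ V ≡ sum (λ t → headTerm t LP * tailTerm a b t LR)
    pointwise = begin
      J L * χ V                                    ≡⟨ *-comm (J L) (χ V) ⟩
      χ V * J L                                    ≡⟨ cong (χ V *_) (J-head pP pR) ⟩
      χ V * J LP                                   ≡⟨ sym (weight-once V refl) ⟩
      sum (λ t → χ (described t) * (χ V * J LP))   ≡⟨ sum-cong-≗ (λ t → sym (term t)) ⟩
      sum (λ t → headTerm t LP * tailTerm a b t LR) ∎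
      where open ≡-Reasoning

  glue : ∑ₗ (P ++ R) (λ L → J L * χ (validFor (D +ᶠ degree L) L)) ≡ sum (λ t → headCount t * tailCount R a b t)
  glue = begin
    ∑ₗ (P ++ R) (λ L → J L * χ (validFor (D +ᶠ degree L) L))
      ≡⟨ ∑ₗ-++ P R _ ⟩
    ∑ₗ P (λ LP → ∑ₗ R (λ LR → J (LP ++ LR) * χ (validFor (D +ᶠ degree (LP ++ LR)) (LP ++ LR))))
      ≡⟨ ∑ₗ-cong P (λ pP → ∑ₗ-cong R (λ pR → pointwise pP pR)) ⟩
    ∑ₗ P (λ LP → ∑ₗ R (λ LR → sum (λ t → headTerm t LP * tailTerm a b t LR)))
      ≡⟨ ∑ₗ-cong P (λ {LP} _ → ∑ₗ-sum R (λ t LR → headTerm t LP * tailTerm a b t LR)) ⟩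
    ∑ₗ P (λ LP → sum (λ t → ∑ₗ R (λ LR → headTerm t LP * tailTerm a b t LR)))
      ≡⟨ ∑ₗ-sum P (λ t LP → ∑ₗ R (λ LR → headTerm t LP * tailTerm a b t LR)) ⟩
    sum (λ t → ∑ₗ P (λ LP → ∑ₗ R (λ LR → headTerm t LP * tailTerm a b t LR)))
      ≡⟨ sum-cong-≗ (λ t → ∑ₗ-product P R (headTerm t) (tailTerm a b t)) ⟩
    sum (λ t → headCount t * tailCount R a b t) ∎
    where open ≡-Reasoning

rename : (ℕ → ℕ) → ℕ × ℕ → ℕ × ℕ
rename f (u , w) = f u , f w

renameLabelling : (ℕ → ℕ) → Labelling → Labelling
renameLabelling f = map (map₁ (rename f))

∑ₗ-rename : ∀ f G (g : Labelling → ℕ) → ∑ₗ (map (rename f) G) g ≡ ∑ₗ G (λ L → g (renameLabelling f L))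
∑ₗ-rename f []      g = refl
∑ₗ-rename f (e ∷ G) g = cong₂ _+_ (∑ₗ-rename f G (λ L → g ((rename f e , true) ∷ L)))
                                  (∑ₗ-rename f G (λ L → g ((rename f e , false) ∷ L)))

BoolInjective : (ℕ → ℕ) → Set
BoolInjective f = ∀ u v → (f u ≡ᵇ f v) ≡ (u ≡ᵇ v)

injective⇒boolInjective : ∀ f → (∀ u v → f u ≡ f v → u ≡ v) → BoolInjective f
injective⇒boolInjective f injective u v with u ≟ v
... | yes refl rewrite ≡ᵇ-refl u | ≡ᵇ-refl (f u) = refl
... | no u≢v   rewrite ≡ᵇ-false u≢v | ≡ᵇ-false (λ e → u≢v (injective u v e)) = refl

module Renaming (f : ℕ → ℕ) (injective : BoolInjective f) where

  covers-rename : ∀ e v → covers (rename f e) (f v) ≡ covers e v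
  covers-rename (u , w) v rewrite injective v u | injective v w = refl

  degree-rename : ∀ L v → degree (renameLabelling f L) (f v) ≡ degree L v
  degree-rename []            v = refl
  degree-rename ((e , s) ∷ L) v rewrite covers-rename e v = cong (χ (s ∧ covers e v) +_) (degree-rename L v)

  validFor-rename : ∀ d L → validFor d (renameLabelling f L) ≡ validFor (λ v → d (f v)) L
  validFor-rename d []                = refl
  validFor-rename d ((e , true)  ∷ L) = cong (locallyOK (λ v → d (f v)) (e , true) ∧_) (validFor-rename d L)
  validFor-rename d ((e , false) ∷ L) = cong (locallyOK (λ v → d (f v)) (e , false) ∧_) (validFor-rename d L)

  at₂-rename : ∀ a b h v → at₂ (f a) (f b) h (f v) ≡ at₂ a b h v
  at₂-rename a b h v rewrite injective v a | injective v b = refl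

  tailCount-rename : ∀ R a b t → tailCount (map (rename f) R) (f a) (f b) t ≡ tailCount R a b t
  tailCount-rename R a b t = trans (∑ₗ-rename f R _) (∑ₗ-cong R (λ {L} _ → term L))
    where
    term : ∀ L → tailTerm (f a) (f b) t (renameLabelling f L) ≡ tailTerm a b t L
    term L rewrite degree-rename L a | degree-rename L b
                 | validFor-rename (at₂ (f a) (f b) (headDegrees t) +ᶠ degree (renameLabelling f L)) L
                 | validFor-cong {d′ = at₂ a b (headDegrees t) +ᶠ degree L} L
                     (λ v → cong₂ _+_ (at₂-rename a b (headDegrees t) v) (degree-rename L v)) = refl

Matrix : ℕ → Set
Matrix n = Vec (Vec ℕ n) n

dot : ∀ {n} → Vec ℕ n → Vec ℕ n → ℕ
dot u w = sum (λ t → lookup u t * lookup w t)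

_*ᵥ_ : ∀ {n} → Matrix n → Vec ℕ n → Vec ℕ n
M *ᵥ w = tabulate (λ s → dot (lookup M s) w)

_ᵥ*_ : ∀ {n} → Vec ℕ n → Matrix n → Vec ℕ n
u ᵥ* M = tabulate (λ t → sum (λ s → lookup u s * lookup (lookup M s) t))

dot-assoc : ∀ {n} (u : Vec ℕ n) M w → dot (u ᵥ* M) w ≡ dot u (M *ᵥ w)
dot-assoc {n} u M w = begin
  sum (λ t → lookup (u ᵥ* M) t * lookup w t)
    ≡⟨ sum-cong-≗ (λ t → cong (_* lookup w t) (lookup∘tabulate _ t)) ⟩
  sum (λ t → sum (λ s → u′ s * M′ s t) * lookup w t)
    ≡⟨ sum-cong-≗ (λ t → *-distribʳ-sum (lookup w t) (λ s → u′ s * M′ s t)) ⟩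
  sum (λ t → sum (λ s → u′ s * M′ s t * lookup w t))
    ≡⟨ ∑-comm (λ t s → u′ s * M′ s t * lookup w t) ⟩
  sum (λ s → sum (λ t → u′ s * M′ s t * lookup w t))
    ≡⟨ sum-cong-≗ (λ s → sum-cong-≗ (λ t → *-assoc (u′ s) (M′ s t) (lookup w t))) ⟩
  sum (λ s → sum (λ t → u′ s * (M′ s t * lookup w t)))
    ≡⟨ sum-cong-≗ (λ s → sym (*-distribˡ-sum (u′ s) (λ t → M′ s t * lookup w t))) ⟩
  sum (λ s → u′ s * dot (lookup M s) w)
    ≡⟨ sum-cong-≗ (λ s → cong (u′ s *_) (sym (lookup∘tabulate _ s))) ⟩
  dot u (M *ᵥ w) ∎
  where
  open ≡-Reasoning
  u′ : Fin n → ℕ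
  u′ = lookup u
  M′ : Fin n → Fin n → ℕ
  M′ s t = lookup (lookup M s) t

rowPower : ∀ {n} → Vec ℕ n → Matrix n → ℕ → Vec ℕ n
rowPower u M zero    = u
rowPower u M (suc i) = rowPower u M i ᵥ* M

colPower : ∀ {n} → Matrix n → Vec ℕ n → ℕ → Vec ℕ n
colPower M w zero    = w
colPower M w (suc r) = M *ᵥ colPower M w r

dot-powers : ∀ {n} (u : Vec ℕ n) M w i r → dot (rowPower u M i) (colPower M w r) ≡ dot u (colPower M w (r + i))
dot-powers u M w zero    r = cong (dot u ∘ colPower M w) (sym (+-identityʳ r))
dot-powers u M w (suc i) r = begin
  dot (rowPower u M i ᵥ* M) (colPower M w r)   ≡⟨ dot-assoc (rowPower u M i) M (colPower M w r) ⟩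
  dot (rowPower u M i) (colPower M w (suc r))  ≡⟨ dot-powers u M w i (suc r) ⟩
  dot u (colPower M w (suc r + i))             ≡⟨ cong (dot u ∘ colPower M w) (sym (+-suc r i)) ⟩
  dot u (colPower M w (r + suc i)) ∎
  where open ≡-Reasoning

linear : List ℕ → (ℕ → ℕ) → ℕ
linear []       f = 0
linear (c ∷ cs) f = c * f 0 + linear cs (f ∘ suc)

combination : ∀ {n} → List ℕ → (ℕ → Vec ℕ n) → Vec ℕ n
combination []       f = replicate _ 0
combination (c ∷ cs) f = tabulate (λ t → c * lookup (f 0) t + lookup (combination cs (f ∘ suc)) t)

linear-cong : ∀ cs {f g : ℕ → ℕ} → (∀ i → f i ≡ g i) → linear cs f ≡ linear cs g
linear-cong []       f≗g = refl
linear-cong (c ∷ cs) f≗g = cong₂ _+_ (cong (c *_) (f≗g 0)) (linear-cong cs (f≗g ∘ suc))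

dot-combination : ∀ {n} cs (f : ℕ → Vec ℕ n) w → dot (combination cs f) w ≡ linear cs (λ i → dot (f i) w)
dot-combination {n} []       f w =
  trans (sum-cong-≗ (λ t → cong (_* lookup w t) (lookup-replicate t 0))) (sum-replicate-zero n)
dot-combination {n} (c ∷ cs) f w = begin
  dot (combination (c ∷ cs) f) w
    ≡⟨ sum-cong-≗ (λ t → cong (_* lookup w t) (lookup∘tabulate _ t)) ⟩
  sum (λ t → (c * lookup (f 0) t + lookup rest t) * lookup w t)
    ≡⟨ sum-cong-≗ (λ t → trans (*-distribʳ-+ (lookup w t) (c * lookup (f 0) t) _)
                               (cong (_+ lookup rest t * lookup w t) (*-assoc c (lookup (f 0) t) (lookup w t)))) ⟩
  sum (λ t → c * (lookup (f 0) t * lookup w t) + lookup rest t * lookup w t)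
    ≡⟨ ∑-distrib-+ (λ t → c * (lookup (f 0) t * lookup w t)) _ ⟩
  sum (λ t → c * (lookup (f 0) t * lookup w t)) + dot rest w
    ≡⟨ cong₂ _+_ (sym (*-distribˡ-sum c (λ t → lookup (f 0) t * lookup w t))) (dot-combination cs (f ∘ suc) w) ⟩
  c * dot (f 0) w + linear cs (λ i → dot (f (suc i)) w) ∎
  where
  open ≡-Reasoning
  rest : Vec ℕ n
  rest = combination cs (f ∘ suc)

recurrence : ∀ {n} (u w : Vec ℕ n) M cs →
             rowPower u M (length cs) ≡ combination cs (rowPower u M) →
             ∀ m → dot u (colPower M w (m + length cs)) ≡ linear cs (λ i → dot u (colPower M w (m + i)))
recurrence u w M cs annihilates m = begin
  dot u (colPower M w (m + length cs))                   ≡⟨ sym (dot-powers u M w (length cs) m) ⟩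
  dot (rowPower u M (length cs)) (colPower M w m)        ≡⟨ cong (λ v → dot v (colPower M w m)) annihilates ⟩
  dot (combination cs (rowPower u M)) (colPower M w m)   ≡⟨ dot-combination cs (rowPower u M) (colPower M w m) ⟩
  linear cs (λ i → dot (rowPower u M i) (colPower M w m)) ≡⟨ linear-cong cs (λ i → dot-powers u M w i m) ⟩
  linear cs (λ i → dot u (colPower M w (m + i))) ∎
  where open ≡-Reasoning

nextEdge-fresh : ∀ κ k → k ≤ proj₁ (nextEdge κ k) × k ≤ proj₂ (nextEdge κ k)
nextEdge-fresh straight k = n≤1+n k , ≤-trans (n≤1+n k) (n≤1+n (suc k))
nextEdge-fresh helix    k = ≤-refl , n≤1+n k
nextEdge-fresh zigzag   k = n≤1+n k , ≤-refl

grow-beyond : ∀ κ r k c d → EdgesAll (Beyond c d k) (grow κ r k (c , d))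
grow-beyond κ zero    k c d = []
grow-beyond κ (suc r) k c d =
    (inj₁ refl , fresh ≤-refl) ∷ (fresh ≤-refl , fresh+ 1) ∷ (fresh+ 1 , fresh+ 2) ∷ (fresh+ 2 , fresh+ 3)
  ∷ (fresh+ 3 , inj₂ (inj₁ refl)) ∷ EdgesAll-map earlier (grow-beyond κ r (k + 4) _ _)
  where
  fresh : ∀ {v} → k ≤ v → Beyond c d k v
  fresh k≤v = inj₂ (inj₂ k≤v)
  fresh+ : ∀ i → Beyond c d k (k + i)
  fresh+ i = fresh (m≤m+n k i)
  earlier : ∀ {v} → Beyond (proj₁ (nextEdge κ k)) (proj₂ (nextEdge κ k)) (k + 4) v → Beyond c d k v
  earlier (inj₁ refl)        = inj₂ (inj₂ (proj₁ (nextEdge-fresh κ k)))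
  earlier (inj₂ (inj₁ refl)) = inj₂ (inj₂ (proj₂ (nextEdge-fresh κ k)))
  earlier (inj₂ (inj₂ k+4≤v)) = inj₂ (inj₂ (≤-trans (m≤m+n k 4) k+4≤v))

-- Sending 0, 1 to a, b and 2 + j to k + j moves the standard tail,
-- grown from (0 , 1) with fresh vertices from 2, to the tail grown from
-- (a , b) with fresh vertices from k.
relocate : ℕ → ℕ → ℕ → ℕ → ℕ
relocate k a b zero          = a
relocate k a b (suc zero)    = b
relocate k a b (suc (suc j)) = k + j

relocate-injective : ∀ {k a b} → a < k → b < k → a ≢ b → ∀ u v → relocate k a b u ≡ relocate k a b v → u ≡ v
relocate-injective {k} a<k b<k a≢b = inj
  where
  low : ∀ {x} j → x < k → x ≢ k + j
  low j x<k e = <⇒≱ x<k (subst (k ≤_) (sym e) (m≤m+n k j))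
  inj : ∀ u v → relocate k _ _ u ≡ relocate k _ _ v → u ≡ v
  inj zero          zero          e = refl
  inj zero          (suc zero)    e = ⊥-elim (a≢b e)
  inj zero          (suc (suc j)) e = ⊥-elim (low j a<k e)
  inj (suc zero)    zero          e = ⊥-elim (a≢b (sym e))
  inj (suc zero)    (suc zero)    e = refl
  inj (suc zero)    (suc (suc j)) e = ⊥-elim (low j b<k e)
  inj (suc (suc i)) zero          e = ⊥-elim (low i a<k (sym e))
  inj (suc (suc i)) (suc zero)    e = ⊥-elim (low i b<k (sym e))
  inj (suc (suc i)) (suc (suc j)) e = cong (λ x → suc (suc x)) (+-cancelˡ-≡ k i j e)

nextEdge-relocate : ∀ κ k a b j → rename (relocate k a b) (nextEdge κ (2 + j)) ≡ nextEdge κ (k + j)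
nextEdge-relocate straight k a b j = cong₂ _,_ (+-suc k j) (trans (+-suc k (suc j)) (cong suc (+-suc k j)))
nextEdge-relocate helix    k a b j = cong₂ _,_ refl (+-suc k j)
nextEdge-relocate zigzag   k a b j = cong₂ _,_ (+-suc k j) refl

grow-relocate : ∀ κ r k a b j c d →
                map (rename (relocate k a b)) (grow κ r (2 + j) (c , d))
                ≡ grow κ r (k + j) (rename (relocate k a b) (c , d))
grow-relocate κ zero    k a b j c d = refl
grow-relocate κ (suc r) k a b j c d
  rewrite sym (+-assoc k j 1) | sym (+-assoc k j 2) | sym (+-assoc k j 3) =
  cong (λ rest → _ ∷ _ ∷ _ ∷ _ ∷ _ ∷ rest)
       (trans (grow-relocate κ r k a b (j + 4) _ _)
              (cong₂ (grow κ r) (sym (+-assoc k j 4)) (nextEdge-relocate κ k a b j)))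

tailCount-relocate : ∀ κ r {k a b} → a < k → b < k → a ≢ b → ∀ t →
                     tailCount (grow κ r k (a , b)) a b t ≡ tailCount (grow κ r 2 (0 , 1)) 0 1 t
tailCount-relocate κ r {k} {a} {b} a<k b<k a≢b t = begin
  tailCount (grow κ r k (a , b)) a b t
    ≡⟨ cong (λ k′ → tailCount (grow κ r k′ (a , b)) a b t) (sym (+-identityʳ k)) ⟩
  tailCount (grow κ r (k + 0) (a , b)) a b t
    ≡⟨ cong (λ G → tailCount G a b t) (sym (grow-relocate κ r k a b 0 0 1)) ⟩
  tailCount (map (rename ρ) (grow κ r 2 (0 , 1))) (ρ 0) (ρ 1) t
    ≡⟨ Renaming.tailCount-rename ρ (injective⇒boolInjective ρ (relocate-injective a<k b<k a≢b))
                                 (grow κ r 2 (0 , 1)) 0 1 t ⟩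
  tailCount (grow κ r 2 (0 , 1)) 0 1 t ∎
  where
  open ≡-Reasoning
  ρ : ℕ → ℕ
  ρ = relocate k a b

-- The hexagon attached to the edge {0 , 1}, without that edge: the first
-- five edges of every tail.
attachedHexagon : Graph
attachedHexagon = (0 , 2) ∷ (2 , 3) ∷ (3 , 4) ∷ (4 , 5) ∷ (5 , 1) ∷ []

exit : Kind → ℕ × ℕ
exit κ = nextEdge κ 2

record NewEdge (e : ℕ × ℕ) : Set where
  field
    2≤a : 2 ≤ proj₁ e
    2≤b : 2 ≤ proj₂ e
    a<6 : proj₁ e < 6
    b<6 : proj₂ e < 6
    a≢b : proj₁ e ≢ proj₂ e

exit-new : ∀ κ → NewEdge (exit κ)
exit-new straight = record { 2≤a = ≤ᵇ⇒≤ 2 3 _ ; 2≤b = ≤ᵇ⇒≤ 2 4 _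
                           ; a<6 = ≤ᵇ⇒≤ 4 6 _ ; b<6 = ≤ᵇ⇒≤ 5 6 _ ; a≢b = λ () }
exit-new helix    = record { 2≤a = ≤ᵇ⇒≤ 2 2 _ ; 2≤b = ≤ᵇ⇒≤ 2 3 _
                           ; a<6 = ≤ᵇ⇒≤ 3 6 _ ; b<6 = ≤ᵇ⇒≤ 4 6 _ ; a≢b = λ () }
exit-new zigzag   = record { 2≤a = ≤ᵇ⇒≤ 2 3 _ ; 2≤b = ≤ᵇ⇒≤ 2 2 _
                           ; a<6 = ≤ᵇ⇒≤ 4 6 _ ; b<6 = ≤ᵇ⇒≤ 3 6 _ ; a≢b = λ () }

beyond-exit⇒2≤ : ∀ κ {v} → Beyond (proj₁ (exit κ)) (proj₂ (exit κ)) 6 v → 2 ≤ v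
beyond-exit⇒2≤ κ (inj₁ refl)        = NewEdge.2≤a (exit-new κ)
beyond-exit⇒2≤ κ (inj₂ (inj₁ refl)) = NewEdge.2≤b (exit-new κ)
beyond-exit⇒2≤ κ (inj₂ (inj₂ 6≤v))  = ≤-trans (≤ᵇ⇒≤ 2 6 _) 6≤v

degree-at-entry : ∀ κ r {LP LR} v → v < 2 → LabellingOf (grow κ r 6 (exit κ)) LR →
                  degree (LP ++ LR) v ≡ degree LP v
degree-at-entry κ r {LP} {LR} v v<2 pR = begin
  degree (LP ++ LR) v          ≡⟨ degree-++ LP LR v ⟩
  degree LP v + degree LR v    ≡⟨ cong (degree LP v +_)
                                       (degree-avoid v pR (EdgesAll-map avoids (grow-beyond κ r 6 _ _))) ⟩
  degree LP v + 0              ≡⟨ +-identityʳ _ ⟩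
  degree LP v ∎
  where
  open ≡-Reasoning
  avoids : ∀ {u} → Beyond (proj₁ (exit κ)) (proj₂ (exit κ)) 6 u → u ≢ v
  avoids beyond refl = <⇒≱ v<2 (beyond-exit⇒2≤ κ beyond)

at₂-entry-vanishes : ∀ {v} h → 2 ≤ v → at₂ 0 1 h v ≡ 0
at₂-entry-vanishes {v} h 2≤v =
  at₂-other v h (λ { refl → <⇒≱ (s≤s z≤n) 2≤v }) (λ { refl → <⇒≱ (s≤s (s≤s z≤n)) 2≤v })

below? : ∀ k G → Dec (EdgesAll (_< k) G)
below? k = All.all? (λ e → (proj₁ e <? k) ×-dec (proj₂ e <? k))

tailVector : Kind → ℕ → Vec ℕ 9
tailVector κ r = tabulate (tailCount (grow κ r 2 (0 , 1)) 0 1)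

-- Row s of the transfer matrix: entry t counts the labellings of the
-- attached hexagon compatible with state s at {0 , 1} and t at its exit.
transferRow : Kind → State → Vec ℕ 9
transferRow κ s = tabulate (HeadCount.headCount attachedHexagon (proj₁ (exit κ)) (proj₂ (exit κ))
                              (at₂ 0 1 (headDegrees s)) (λ L → χ (degreesAt L 0 1 ==₂ tailDegrees s)))

transfer : Kind → Matrix 9
transfer κ = tabulate (transferRow κ)

-- Entry t counts the labellings of the first hexagon compatible with state t at {0 , 1}.
initial : Vec ℕ 9
initial = tabulate (HeadCount.headCount hexagon₁ 0 1 (λ _ → 0) (λ _ → 1))

glued-count : ∀ κ r {k a b} → a < k → b < k → a ≢ b → (h : State → ℕ) →
              sum (λ t → h t * tailCount (grow κ r k (a , b)) a b t) ≡ dot (tabulate h) (tailVector κ r)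
glued-count κ r a<k b<k a≢b h = sum-cong-≗ λ t →
  cong₂ _*_ (sym (lookup∘tabulate h t))
            (trans (tailCount-relocate κ r a<k b<k a≢b t)
                   (sym (lookup∘tabulate (tailCount (grow κ r 2 (0 , 1)) 0 1) t)))

tailVector-step : ∀ κ r → tailVector κ (suc r) ≡ transfer κ *ᵥ tailVector κ r
tailVector-step κ r = tabulate-cong step
  where
  open NewEdge (exit-new κ)
  a b : ℕ
  a = proj₁ (exit κ)
  b = proj₂ (exit κ)

  step : ∀ s → tailCount (grow κ (suc r) 2 (0 , 1)) 0 1 s ≡ dot (lookup (transfer κ) s) (tailVector κ r)
  step s = begin
    ∑ₗ (attachedHexagon ++ grow κ r 6 (a , b)) (tailTerm 0 1 s)
      ≡⟨ glue ⟩
    sum (λ t → headCount t * tailCount (grow κ r 6 (a , b)) a b t)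
      ≡⟨ glued-count κ r a<6 b<6 a≢b headCount ⟩
    dot (transferRow κ s) (tailVector κ r)
      ≡⟨ cong (λ row → dot row (tailVector κ r)) (sym (lookup∘tabulate (transferRow κ) s)) ⟩
    dot (lookup (transfer κ) s) (tailVector κ r) ∎
    where
    open ≡-Reasoning
    open Gluing attachedHexagon (grow κ r 6 (a , b)) a b 6 a<6 b<6 a≢b
                (toWitness {a? = below? 6 attachedHexagon} _) (grow-beyond κ r 6 a b)
                (at₂ 0 1 (headDegrees s)) (λ beyond → at₂-entry-vanishes _ (beyond-exit⇒2≤ κ beyond))
                (λ L → χ (degreesAt L 0 1 ==₂ tailDegrees s))
                (λ {LP} _ pR → cong (λ d → χ (d ==₂ tailDegrees s))
                                    (cong₂ _,_ (degree-at-entry κ r {LP} 0 (s≤s z≤n) pR)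
                                               (degree-at-entry κ r {LP} 1 (s≤s (s≤s z≤n)) pR)))

Ψ-chain : ∀ κ r → Ψ (chain κ (suc r)) ≡ dot initial (tailVector κ r)
Ψ-chain κ r = begin
  Ψ (chain κ (suc r))
    ≡⟨ Ψ≡∑valid (chain κ (suc r)) ⟩
  ∑ₗ (hexagon₁ ++ R) (λ L → χ (valid L))
    ≡⟨ ∑ₗ-cong (hexagon₁ ++ R) (λ {L} _ → sym (+-identityʳ (χ (valid L)))) ⟩
  ∑ₗ (hexagon₁ ++ R) (λ L → 1 * χ (validFor ((λ _ → 0) +ᶠ degree L) L))
    ≡⟨ glue ⟩
  sum (λ t → headCount t * tailCount R 0 1 t)
    ≡⟨ glued-count κ r {6} (s≤s z≤n) (s≤s (s≤s z≤n)) (λ ()) headCount ⟩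
  dot initial (tailVector κ r) ∎
  where
  open ≡-Reasoning
  R : Graph
  R = grow κ r 6 (0 , 1)
  open Gluing hexagon₁ R 0 1 6 (s≤s z≤n) (s≤s (s≤s z≤n)) (λ ()) (toWitness {a? = below? 6 hexagon₁} _)
              (grow-beyond κ r 6 0 1) (λ _ → 0) (λ _ → refl) (λ _ → 1) (λ _ _ → refl)

transferTable : Kind → Matrix 9
transferTable straight =
  ( (0 ∷ 0 ∷ 0 ∷ 0 ∷ 1 ∷ 0 ∷ 0 ∷ 0 ∷ 0 ∷ [])
  ∷ (0 ∷ 0 ∷ 0 ∷ 0 ∷ 1 ∷ 1 ∷ 0 ∷ 0 ∷ 0 ∷ [])
  ∷ (0 ∷ 0 ∷ 0 ∷ 1 ∷ 0 ∷ 1 ∷ 0 ∷ 0 ∷ 0 ∷ [])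
  ∷ (0 ∷ 0 ∷ 0 ∷ 0 ∷ 1 ∷ 0 ∷ 0 ∷ 1 ∷ 0 ∷ [])
  ∷ (0 ∷ 0 ∷ 0 ∷ 0 ∷ 2 ∷ 1 ∷ 0 ∷ 1 ∷ 1 ∷ [])
  ∷ (0 ∷ 0 ∷ 0 ∷ 1 ∷ 1 ∷ 1 ∷ 1 ∷ 0 ∷ 1 ∷ [])
  ∷ (0 ∷ 1 ∷ 0 ∷ 0 ∷ 0 ∷ 0 ∷ 0 ∷ 1 ∷ 0 ∷ [])
  ∷ (0 ∷ 1 ∷ 1 ∷ 0 ∷ 1 ∷ 0 ∷ 0 ∷ 1 ∷ 1 ∷ [])
  ∷ (0 ∷ 0 ∷ 1 ∷ 0 ∷ 1 ∷ 0 ∷ 1 ∷ 0 ∷ 1 ∷ [])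
  ∷ [] )
transferTable zigzag =
  ( (0 ∷ 0 ∷ 1 ∷ 0 ∷ 1 ∷ 0 ∷ 0 ∷ 0 ∷ 1 ∷ [])
  ∷ (0 ∷ 0 ∷ 1 ∷ 0 ∷ 1 ∷ 1 ∷ 0 ∷ 0 ∷ 1 ∷ [])
  ∷ (0 ∷ 0 ∷ 0 ∷ 0 ∷ 1 ∷ 1 ∷ 0 ∷ 0 ∷ 1 ∷ [])
  ∷ (0 ∷ 0 ∷ 1 ∷ 0 ∷ 1 ∷ 0 ∷ 1 ∷ 0 ∷ 1 ∷ [])
  ∷ (0 ∷ 0 ∷ 1 ∷ 1 ∷ 1 ∷ 1 ∷ 1 ∷ 0 ∷ 1 ∷ [])
  ∷ (0 ∷ 0 ∷ 0 ∷ 1 ∷ 1 ∷ 1 ∷ 1 ∷ 0 ∷ 1 ∷ [])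
  ∷ (0 ∷ 1 ∷ 0 ∷ 0 ∷ 0 ∷ 0 ∷ 0 ∷ 1 ∷ 0 ∷ [])
  ∷ (0 ∷ 1 ∷ 0 ∷ 0 ∷ 1 ∷ 0 ∷ 0 ∷ 1 ∷ 0 ∷ [])
  ∷ (0 ∷ 0 ∷ 0 ∷ 0 ∷ 1 ∷ 0 ∷ 0 ∷ 1 ∷ 0 ∷ [])
  ∷ [] )
transferTable helix =
  ( (0 ∷ 0 ∷ 0 ∷ 0 ∷ 1 ∷ 0 ∷ 1 ∷ 0 ∷ 1 ∷ [])
  ∷ (0 ∷ 0 ∷ 0 ∷ 0 ∷ 1 ∷ 0 ∷ 1 ∷ 1 ∷ 1 ∷ [])
  ∷ (0 ∷ 0 ∷ 0 ∷ 0 ∷ 1 ∷ 0 ∷ 0 ∷ 1 ∷ 1 ∷ [])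
  ∷ (0 ∷ 0 ∷ 1 ∷ 0 ∷ 1 ∷ 0 ∷ 1 ∷ 0 ∷ 1 ∷ [])
  ∷ (0 ∷ 1 ∷ 1 ∷ 0 ∷ 1 ∷ 0 ∷ 1 ∷ 1 ∷ 1 ∷ [])
  ∷ (0 ∷ 1 ∷ 1 ∷ 0 ∷ 1 ∷ 0 ∷ 0 ∷ 1 ∷ 1 ∷ [])
  ∷ (0 ∷ 0 ∷ 0 ∷ 1 ∷ 0 ∷ 1 ∷ 0 ∷ 0 ∷ 0 ∷ [])
  ∷ (0 ∷ 0 ∷ 0 ∷ 1 ∷ 1 ∷ 1 ∷ 0 ∷ 0 ∷ 0 ∷ [])
  ∷ (0 ∷ 0 ∷ 0 ∷ 0 ∷ 1 ∷ 1 ∷ 0 ∷ 0 ∷ 0 ∷ [])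
  ∷ [] )

-- The tables are the transfer matrices, by evaluation of their definition;
-- working with the tables keeps the later evaluations cheap.
transfer≡table : ∀ κ → transfer κ ≡ transferTable κ
transfer≡table straight = refl
transfer≡table zigzag   = refl
transfer≡table helix    = refl

transferSeq : Kind → ℕ → ℕ
transferSeq κ zero    = 1
transferSeq κ (suc r) = dot initial (colPower (transferTable κ) (tailVector κ 0) r)

tailVector-power : ∀ κ r → tailVector κ r ≡ colPower (transferTable κ) (tailVector κ 0) r
tailVector-power κ zero    = refl
tailVector-power κ (suc r) = trans (tailVector-step κ r) (cong₂ _*ᵥ_ (transfer≡table κ) (tailVector-power κ r))

Transfers : Kind → (ℕ → ℕ) → Set
Transfers κ t = ∀ n → t n ≡ transferSeq κ n

chain-transfers : ∀ κ → Transfers κ (withZero (chain κ))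
chain-transfers κ zero    = refl
chain-transfers κ (suc r) = trans (Ψ-chain κ r) (cong (dot initial) (tailVector-power κ r))

-- A relation annihilating the initial vector, together with its instance
-- at n = 0 (where the value 1 is not a count), yields the recurrence.
transfer-recurrence : ∀ {κ t} → Transfers κ t → ∀ cs →
                      rowPower initial (transferTable κ) (length cs) ≡ combination cs (rowPower initial (transferTable κ)) →
                      transferSeq κ (length cs) ≡ linear cs (transferSeq κ) →
                      ∀ n → t (n + length cs) ≡ linear cs (λ i → t (n + i))
transfer-recurrence {κ} {t} t≗seq cs annihilates base n = begin
  t (n + length cs)                         ≡⟨ t≗seq (n + length cs) ⟩
  transferSeq κ (n + length cs)             ≡⟨ seq-recurrence n ⟩
  linear cs (λ i → transferSeq κ (n + i))   ≡⟨ linear-cong cs (λ i → sym (t≗seq (n + i))) ⟩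
  linear cs (λ i → t (n + i)) ∎
  where
  open ≡-Reasoning
  seq-recurrence : ∀ n → transferSeq κ (n + length cs) ≡ linear cs (λ i → transferSeq κ (n + i))
  seq-recurrence zero    = base
  seq-recurrence (suc m) = recurrence initial (tailVector κ 0) (transferTable κ) cs annihilates m

recurrence-by-evaluation :
  ∀ {κ t} → Transfers κ t → ∀ cs →
  {True (≡-dec _≟_ (rowPower initial (transferTable κ) (length cs))
                   (combination cs (rowPower initial (transferTable κ))))} →
  {True (transferSeq κ (length cs) ≟ linear cs (transferSeq κ))} →
  ∀ n → t (n + length cs) ≡ linear cs (λ i → t (n + i))
recurrence-by-evaluation t≗seq cs {annihilates} {base} =
  transfer-recurrence t≗seq cs (toWitness annihilates) (toWitness base)

value-by-evaluation : ∀ {κ t} → Transfers κ t → ∀ n v → {True (transferSeq κ n ≟ v)} → t n ≡ v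
value-by-evaluation t≗seq n v {ok} = trans (t≗seq n) (toWitness ok)

-- The coefficients of the three recurrences, lowest offset first.
ℓ-coefficients z-coefficients h-coefficients : List ℕ
ℓ-coefficients = 1 ∷ 1 ∷ 0 ∷ 0 ∷ 4 ∷ []
z-coefficients = 1 ∷ 5 ∷ 7 ∷ 7 ∷ 6 ∷ 1 ∷ 3 ∷ []
h-coefficients = 2 ∷ 4 ∷ 7 ∷ 6 ∷ 12 ∷ 7 ∷ 1 ∷ []

ℓ-shape : ∀ (f : ℕ → ℕ) n → linear ℓ-coefficients (λ i → f (n + i)) ≡ 4 * f (n + 4) + f (n + 1) + f n
ℓ-shape f n rewrite +-identityʳ n = arithmetic (f n) (f (n + 1)) (f (n + 2)) (f (n + 3)) (f (n + 4))
  where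
  arithmetic : ∀ a b c d e → 1 * a + (1 * b + (0 * c + (0 * d + (4 * e + 0)))) ≡ 4 * e + b + a
  arithmetic = solve-∀

z-shape : ∀ (f : ℕ → ℕ) n → linear z-coefficients (λ i → f (n + i))
                          ≡ 3 * f (n + 6) + f (n + 5) + 6 * f (n + 4) + 7 * f (n + 3) + 7 * f (n + 2) + 5 * f (n + 1) + f n
z-shape f n rewrite +-identityʳ n =
  arithmetic (f n) (f (n + 1)) (f (n + 2)) (f (n + 3)) (f (n + 4)) (f (n + 5)) (f (n + 6))
  where
  arithmetic : ∀ a b c d e g i → 1 * a + (5 * b + (7 * c + (7 * d + (6 * e + (1 * g + (3 * i + 0))))))
                                 ≡ 3 * i + g + 6 * e + 7 * d + 7 * c + 5 * b + a
  arithmetic = solve-∀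

h-shape : ∀ (f : ℕ → ℕ) n → linear h-coefficients (λ i → f (n + i))
                          ≡ f (n + 6) + 7 * f (n + 5) + 12 * f (n + 4) + 6 * f (n + 3) + 7 * f (n + 2) + 4 * f (n + 1) + 2 * f n
h-shape f n rewrite +-identityʳ n =
  arithmetic (f n) (f (n + 1)) (f (n + 2)) (f (n + 3)) (f (n + 4)) (f (n + 5)) (f (n + 6))
  where
  arithmetic : ∀ a b c d e g i → 2 * a + (4 * b + (7 * c + (6 * d + (12 * e + (7 * g + (1 * i + 0))))))
                                 ≡ i + 7 * g + 12 * e + 6 * d + 7 * c + 4 * b + 2 * a
  arithmetic = solve-∀

mainTheorem7 :
  ((∀ n → ℓ (n + 5) ≡ 4 * ℓ (n + 4) + ℓ (n + 1) + ℓ n)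
    × ℓ 0 ≡ 1 × ℓ 1 ≡ 5 × ℓ 2 ≡ 20 × ℓ 3 ≡ 79 × ℓ 4 ≡ 317)
  × ((∀ n → z (n + 7) ≡ 3 * z (n + 6) + z (n + 5) + 6 * z (n + 4) + 7 * z (n + 3)
                        + 7 * z (n + 2) + 5 * z (n + 1) + z n)
    × z 0 ≡ 1 × z 1 ≡ 5 × z 2 ≡ 20 × z 3 ≡ 75 × z 4 ≡ 288 × z 5 ≡ 1105 × z 6 ≡ 4234)
  × ((∀ n → h (n + 7) ≡ h (n + 6) + 7 * h (n + 5) + 12 * h (n + 4) + 6 * h (n + 3)
                        + 7 * h (n + 2) + 4 * h (n + 1) + 2 * h n)
    × h 0 ≡ 1 × h 1 ≡ 5 × h 2 ≡ 20 × h 3 ≡ 75 × h 4 ≡ 288 × h 5 ≡ 1094 × h 6 ≡ 4171)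
mainTheorem7 =
    ( (λ n → trans (recurrence-by-evaluation ℓ-transfers ℓ-coefficients n) (ℓ-shape ℓ n))
    , refl , ℓ-value 1 5 , ℓ-value 2 20 , ℓ-value 3 79 , ℓ-value 4 317 )
  , ( (λ n → trans (recurrence-by-evaluation z-transfers z-coefficients n) (z-shape z n))
    , refl , z-value 1 5 , z-value 2 20 , z-value 3 75 , z-value 4 288 , z-value 5 1105 , z-value 6 4234 )
  , ( (λ n → trans (recurrence-by-evaluation h-transfers h-coefficients n) (h-shape h n))
    , refl , h-value 1 5 , h-value 2 20 , h-value 3 75 , h-value 4 288 , h-value 5 1094 , h-value 6 4171 )
  where
  ℓ-transfers : Transfers straight ℓ
  ℓ-transfers = chain-transfers straight
  z-transfers : Transfers zigzag z
  z-transfers = chain-transfers zigzag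
  h-transfers : Transfers helix h
  h-transfers = chain-transfers helix
  ℓ-value : ∀ n v → {True (transferSeq straight n ≟ v)} → ℓ n ≡ v
  ℓ-value = value-by-evaluation ℓ-transfers
  z-value : ∀ n v → {True (transferSeq zigzag n ≟ v)} → z n ≡ v
  z-value = value-by-evaluation z-transfers
  h-value : ∀ n v → {True (transferSeq helix n ≟ v)} → h n ≡ v
  h-value = value-by-evaluation h-transfers
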